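{- Let $D$ be a diagram. Then $D$ can be obtained by applying a (possibly empty) finite sequence of Kohnert moves to the key diagram $D_b$ of some weak composition $b$ if and only if for every position $(i,j)\in\mathbb{N}\times\mathbb{N}$ with $j>1$ (row $i$, column $j$), the number of cells of $D$ weakly above $(i,j)$ in column $j$ is at most the number of cells of $D$ weakly above $(i,j-1)$ in column $j-1$.
   Context: A diagram is a finite set of cells placed at positions of $\mathbb{N}\times\mathbb{N}$ (row $r\ge 1$, column $c\ge 1$), with rows indexed from the bottom, row $1$ being the lowest. A weak composition is a finite sequence $b=(b_1,\dots,b_n)$ of nonnegative integers; its key diagram $D_b$ has, for each $r$, $b_r$ cells in row $r$, occupying columns $1,\dots,b_r$. A Kohnert move on a diagram selects the rightmost cell of some row and moves it down within its column to the first empty position below it (jumping over any occupied positions), provided such an empty position exists in a row $\ge 1$. -}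

module Defs where

open import Data.Bool using (Bool; true; false; _∧_; T)
open import Data.Nat using (ℕ; zero; suc; _+_; _∸_; _≤_; _<_; _≤ᵇ_; z≤n; s≤s)
open import Data.Nat.Properties
  using (≤ᵇ⇒≤; ≤-trans; m≤m+n; m≤n+m; +-mono-≤; ≤-refl; n≤1+n)
open import Data.List using (List; []; _∷_; length)
open import Data.Nat.ListAction using (sum)
open import Data.Product using (Σ; ∃; ∃-syntax; _×_; _,_)
open import Data.Sum using (_⊎_)
open import Data.Unit using (tt)
open import Relation.Nullary using (¬_)
open import Relation.Binary.PropositionalEquality using (_≡_; refl)
open import Relation.Binary.Construct.Closure.ReflexiveTransitive using (Star)

-- A diagram is a finite set of cells in ℕ × ℕ with rows and
-- columns ≥ 1.  `cell r c ≡ true` means there is a cell in row r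
-- (row 1 is the lowest) and column c.

record Diagram : Set where
  field
    cell    : ℕ → ℕ → Bool
    bound   : ℕ
    bounded : ∀ r c → cell r c ≡ true → (1 ≤ r) × (1 ≤ c) × (r < bound) × (c < bound)
open Diagram public

_≈ᴰ_ : Diagram → Diagram → Set
D ≈ᴰ E = ∀ r c → cell D r c ≡ cell E r c

-- entry b r = b_r (1-indexed), and 0 outside 1 ≤ r ≤ length b.
entry : List ℕ → ℕ → ℕ
entry b         zero          = 0
entry []        (suc r)       = 0
entry (x ∷ b)   (suc zero)    = x
entry (x ∷ b)   (suc (suc r)) = entry b (suc r)

private
  entry≤sum : ∀ b r → entry b r ≤ sum b
  entry≤sum b       zero          = z≤n
  entry≤sum []      (suc r)       = z≤n
  entry≤sum (x ∷ b) (suc zero)    = m≤m+n x (sum b)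
  entry≤sum (x ∷ b) (suc (suc r)) = ≤-trans (entry≤sum b (suc r)) (m≤n+m (sum b) x)

  entry-pos : ∀ b r → 1 ≤ entry b r → (1 ≤ r) × (r ≤ length b)
  entry-pos b       zero          ()
  entry-pos []      (suc r)       ()
  entry-pos (x ∷ b) (suc zero)    p = s≤s z≤n , s≤s z≤n
  entry-pos (x ∷ b) (suc (suc r)) p with entry-pos b (suc r) p
  ... | _ , q = s≤s z≤n , s≤s q

keyCell : List ℕ → ℕ → ℕ → Bool
keyCell b r c = (1 ≤ᵇ c) ∧ (c ≤ᵇ entry b r)

private
  keyBounded : ∀ b r c → keyCell b r c ≡ true →
               (1 ≤ r) × (1 ≤ c) × (r < suc (length b + sum b)) × (c < suc (length b + sum b))
  keyBounded b r c eq with 1 ≤ᵇ c in e1 | c ≤ᵇ entry b r in e2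
  keyBounded b r c refl | true | true =
    let 1≤c = ≤ᵇ⇒≤ 1 c (subst' e1)
        c≤e = ≤ᵇ⇒≤ c (entry b r) (subst' e2)
        1≤r , r≤l = entry-pos b r (≤-trans 1≤c c≤e)
    in 1≤r , 1≤c
       , s≤s (≤-trans r≤l (m≤m+n (length b) (sum b)))
       , s≤s (≤-trans c≤e (≤-trans (entry≤sum b r) (m≤n+m (sum b) (length b))))
    where
      subst' : ∀ {x} → x ≡ true → T x
      subst' refl = tt

key : List ℕ → Diagram
key b = record
  { cell    = keyCell b
  ; bound   = suc (length b + sum b)
  ; bounded = keyBounded b
  }

KohnertMove : Diagram → Diagram → Set
KohnertMove D E =
  Σ ℕ λ r → Σ ℕ λ c → Σ ℕ λ r' →
      cell D r c ≡ true
    × (∀ c' → c < c' → cell D r c' ≡ false)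
    × 1 ≤ r' × r' < r
    × cell D r' c ≡ false
    × (∀ r'' → r' < r'' → r'' < r → cell D r'' c ≡ true)
    × cell E r c ≡ false
    × cell E r' c ≡ true
    × (∀ x y → ¬ ((x , y) ≡ (r , c)) → ¬ ((x , y) ≡ (r' , c)) →
               cell E x y ≡ cell D x y)

KohnertReach : Diagram → Diagram → Set
KohnertReach = Star KohnertMove

KohnertObtainable : Diagram → Set
KohnertObtainable D = ∃[ b ] ∃[ E ] (KohnertReach (key b) E × E ≈ᴰ D)

countFrom : (ℕ → Bool) → ℕ → ℕ → ℕ
countFrom p i zero    = 0
countFrom p i (suc k) with p i
... | true  = suc (countFrom p (suc i) k)
... | false = countFrom p (suc i) k

-- number of cells of D in column j in rows ≥ i (all cells lie below
-- the bound, so counting rows i,…,bound-1 counts them all).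
countAbove : Diagram → ℕ → ℕ → ℕ
countAbove D i j = countFrom (λ r → cell D r j) i (bound D ∸ i)

ColumnCondition : Diagram → Set
ColumnCondition D =
  ∀ i j → 1 ≤ i → 1 < j → countAbove D i j ≤ countAbove D i (j ∸ 1)

-- A key diagram has every column dominated, row by row from any height upwards, by the column to
-- its left.  A Kohnert move lowers the rightmost cell (y, c) of its row across a run of cells to
-- (x, c); it only decreases the counts of column c, and only on the rows x < i ≤ y, where column
-- c still keeps one more cell than column c + 1 because (y, c + 1) is empty.
--
-- Conversely, call (a, c) a hole when it is a cell and (a + 1, c) is empty.  Raising the cell of
-- the topmost, and then leftmost, hole keeps the column condition, is undone by a Kohnert move,
-- and strictly increases the sum of all column counts inside the fixed bounding box, so after
-- finitely many steps no hole remains.  In a hole-free diagram each column runs from its lowest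
-- cell to the top of the box, and the column condition then forces every row to be left-justified:
-- the diagram is a key diagram.

module Submission where

open import Defs
open import Data.Bool using (Bool; true; false; _∨_)
open import Data.Bool.Properties using (T-≡; T-∧; ⇔→≡) renaming (_≟_ to _≟ᴮ_)
open import Data.Nat using (ℕ; zero; suc; _+_; _*_; _∸_; _≤_; _<_; _⊔_; z≤n; s≤s; z<s; _≟_; _≤?_; _<?_)
open import Data.Nat.Properties
open import Data.Product using (∃-syntax; _×_; _,_; proj₁; proj₂)
open import Data.Sum using (_⊎_; inj₁; inj₂; [_,_])
open import Data.List using (List; applyUpTo)
open import Function using (_∘_; _⇔_; Equivalence; mk⇔)
open import Relation.Nullary using (¬_; does; yes; no; contradiction)
open import Relation.Nullary.Decidable using (dec-true; dec-false; _×-dec_)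
open import Relation.Unary using (Decidable)
open import Relation.Binary.PropositionalEquality hiding ([_])
open import Relation.Binary.Construct.Closure.ReflexiveTransitive using (ε; _◅_; _◅◅_)

-- Counting cells in a window of rows

countFrom-true : ∀ {p i} k → p i ≡ true → countFrom p i (suc k) ≡ suc (countFrom p (suc i) k)
countFrom-true k eq rewrite eq = refl

countFrom-false : ∀ {p i} k → p i ≡ false → countFrom p i (suc k) ≡ countFrom p (suc i) k
countFrom-false k eq rewrite eq = refl

countFrom-≤ : ∀ p i k → countFrom p i k ≤ k
countFrom-≤ p i zero = z≤n
countFrom-≤ p i (suc k) with p i
... | true  = s≤s (countFrom-≤ p (suc i) k)
... | false = m≤n⇒m≤1+n (countFrom-≤ p (suc i) k)

countFrom-cong : ∀ {p q} i k → (∀ r → i ≤ r → p r ≡ q r) → countFrom p i k ≡ countFrom q i k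
countFrom-cong i zero eq = refl
countFrom-cong {p} {q} i (suc k) eq with p i | q i | eq i ≤-refl
... | true  | .true  | refl = cong suc (countFrom-cong (suc i) k (λ r → eq r ∘ <⇒≤))
... | false | .false | refl = countFrom-cong (suc i) k (λ r → eq r ∘ <⇒≤)

countFrom-mono : ∀ {p q} i k → (∀ r → p r ≡ true → q r ≡ true) → countFrom p i k ≤ countFrom q i k
countFrom-mono i zero imp = z≤n
countFrom-mono {p} {q} i (suc k) imp with p i in pi | q i in qi
... | true  | true  = s≤s (countFrom-mono (suc i) k imp)
... | false | true  = m≤n⇒m≤1+n (countFrom-mono (suc i) k imp)
... | false | false = countFrom-mono (suc i) k imp
... | true  | false with () ← trans (sym (imp i pi)) qi

countFrom-full : ∀ {p} i k → (∀ r → i ≤ r → r < i + k → p r ≡ true) → countFrom p i k ≡ k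
countFrom-full i zero full = refl
countFrom-full {p} i (suc k) full
  rewrite countFrom-true {p} k (full i ≤-refl (m<m+n i z<s)) =
  cong suc (countFrom-full (suc i) k (λ r i<r r<i+k → full r (<⇒≤ i<r) (subst (r <_) (sym (+-suc i k)) r<i+k)))

countFrom-empty : ∀ {p} i k → (∀ r → i ≤ r → p r ≡ false) → countFrom p i k ≡ 0
countFrom-empty i zero empty = refl
countFrom-empty {p} i (suc k) empty
  rewrite countFrom-false {p} k (empty i ≤-refl) = countFrom-empty (suc i) k (λ r → empty r ∘ <⇒≤)

countFrom-+ : ∀ p i k m → countFrom p i (k + m) ≡ countFrom p i k + countFrom p (i + k) m
countFrom-+ p i zero m rewrite +-identityʳ i = refl
countFrom-+ p i (suc k) m with p i
... | true  rewrite countFrom-+ p (suc i) k m | +-suc i k = refl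
... | false rewrite countFrom-+ p (suc i) k m | +-suc i k = refl

countFrom-insert : ∀ {p q x} i k → (∀ r → r ≢ x → q r ≡ p r) → p x ≡ false → q x ≡ true →
                   i ≤ x → x < i + k → countFrom q i k ≡ suc (countFrom p i k)
countFrom-insert i zero agree px qx i≤x x<i+0 =
  contradiction (≤-trans x<i+0 (≤-reflexive (+-identityʳ i))) (≤⇒≯ i≤x)
countFrom-insert {p} {q} {x} i (suc k) agree px qx i≤x x<i+k with i ≟ x
... | yes refl rewrite countFrom-true {q} k qx | countFrom-false {p} k px =
  cong suc (countFrom-cong (suc i) k (λ r i<r → agree r (>⇒≢ i<r)))
countFrom-insert {p} {q} {x} i (suc k) agree px qx i≤x x<i+k | no i≢x
  with q i | p i | agree i i≢x
     | countFrom-insert (suc i) k agree px qx (≤∧≢⇒< i≤x i≢x) (subst (x <_) (+-suc i k) x<i+k)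
... | true  | .true  | refl | ih = cong suc ih
... | false | .false | refl | ih = ih

count : (ℕ → Bool) → ℕ → ℕ → ℕ
count p U i = countFrom p i (U ∸ i)

window-split : ∀ {i m U} → i ≤ m → m ≤ U → U ∸ i ≡ (m ∸ i) + (U ∸ m)
window-split {i} {m} {U} i≤m m≤U = begin
  U ∸ i                ≡⟨ cong (_∸ i) (sym (m+[n∸m]≡n m≤U)) ⟩
  (m + (U ∸ m)) ∸ i    ≡⟨ +-∸-comm (U ∸ m) i≤m ⟩
  (m ∸ i) + (U ∸ m)    ∎
  where open ≡-Reasoning

count-split : ∀ p {U i m} → i ≤ m → m ≤ U → count p U i ≡ countFrom p i (m ∸ i) + count p U m
count-split p {U} {i} {m} i≤m m≤U = begin
  countFrom p i (U ∸ i)                                   ≡⟨ cong (countFrom p i) (window-split i≤m m≤U) ⟩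
  countFrom p i ((m ∸ i) + (U ∸ m))                       ≡⟨ countFrom-+ p i (m ∸ i) (U ∸ m) ⟩
  countFrom p i (m ∸ i) + countFrom p (i + (m ∸ i)) (U ∸ m)
    ≡⟨ cong (λ k → countFrom p i (m ∸ i) + countFrom p k (U ∸ m)) (m+[n∸m]≡n i≤m) ⟩
  countFrom p i (m ∸ i) + count p U m                     ∎
  where open ≡-Reasoning

count-true : ∀ {p U i} → i < U → p i ≡ true → count p U i ≡ suc (count p U (suc i))
count-true {p} {U} i<U pi rewrite +-∸-assoc 1 i<U = countFrom-true {p} _ pi

count-false : ∀ {p U i} → i < U → p i ≡ false → count p U i ≡ count p U (suc i)
count-false {p} {U} i<U pi rewrite +-∸-assoc 1 i<U = countFrom-false {p} _ pi

count-≤ : ∀ p U i → count p U i ≤ U ∸ i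
count-≤ p U i = countFrom-≤ p i (U ∸ i)

count-cong : ∀ {p q} U i → (∀ r → i ≤ r → p r ≡ q r) → count p U i ≡ count q U i
count-cong U i = countFrom-cong i (U ∸ i)

count-mono : ∀ {p q} U i → (∀ r → p r ≡ true → q r ≡ true) → count p U i ≤ count q U i
count-mono U i = countFrom-mono i (U ∸ i)

count-full : ∀ {p U i} → (∀ r → i ≤ r → r < U → p r ≡ true) → count p U i ≡ U ∸ i
count-full {p} {U} {i} full with i ≤? U
... | yes i≤U =
  countFrom-full i (U ∸ i) (λ r i≤r r<i+U∸i → full r i≤r (subst (r <_) (m+[n∸m]≡n i≤U) r<i+U∸i))
... | no i≰U rewrite m≤n⇒m∸n≡0 (<⇒≤ (≰⇒> i≰U)) = refl

count-insert : ∀ {p q x} U i → (∀ r → r ≢ x → q r ≡ p r) → p x ≡ false → q x ≡ true →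
               i ≤ x → x < U → count q U i ≡ suc (count p U i)
count-insert U i agree px qx i≤x x<U =
  countFrom-insert i (U ∸ i) agree px qx i≤x (subst (_ <_) (sym (m+[n∸m]≡n (≤-trans i≤x (<⇒≤ x<U)))) x<U)

count-extend : ∀ {p U₀ U} i → (∀ r → U₀ ≤ r → p r ≡ false) → U₀ ≤ U → count p U₀ i ≡ count p U i
count-extend {p} {U₀} {U} i empty U₀≤U = sym (begin
  countFrom p i (U ∸ i)                          ≡⟨ cong (countFrom p i) (sym (m+[n∸m]≡n window≤)) ⟩
  countFrom p i ((U₀ ∸ i) + rest)                ≡⟨ countFrom-+ p i (U₀ ∸ i) rest ⟩
  count p U₀ i + countFrom p (i + (U₀ ∸ i)) rest
    ≡⟨ cong (count p U₀ i +_) (countFrom-empty (i + (U₀ ∸ i)) rest (λ r → empty r ∘ ≤-trans (m≤n+m∸n U₀ i))) ⟩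
  count p U₀ i + 0                                ≡⟨ +-identityʳ _ ⟩
  count p U₀ i                                    ∎)
  where
  open ≡-Reasoning
  rest : ℕ
  rest = (U ∸ i) ∸ (U₀ ∸ i)
  window≤ : U₀ ∸ i ≤ U ∸ i
  window≤ = ∸-monoˡ-≤ i U₀≤U

count-<-window : ∀ {p U i} → p i ≡ false → i < U → count p U i < U ∸ i
count-<-window {p} {U} {i} pi i<U = begin-strict
  count p U i       ≡⟨ count-false i<U pi ⟩
  count p U (suc i) ≤⟨ count-≤ p U (suc i) ⟩
  U ∸ suc i         <⟨ n<1+n (U ∸ suc i) ⟩
  suc (U ∸ suc i)   ≡⟨ sym (+-∸-assoc 1 i<U) ⟩
  U ∸ i             ∎
  where open ≤-Reasoning

insert : ℕ → (ℕ → Bool) → ℕ → Bool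
insert x p r = does (r ≟ x) ∨ p r

insert-here : ∀ x p → insert x p x ≡ true
insert-here x p rewrite dec-true (x ≟ x) refl = refl

insert-elsewhere : ∀ {x} p {r} → r ≢ x → insert x p r ≡ p r
insert-elsewhere {x} p {r} r≢x rewrite dec-false (r ≟ x) r≢x = refl

record CellLowered (p q : ℕ → Bool) (x y : ℕ) : Set where
  field
    x<y       : x < y
    p-at-y    : p y ≡ true
    p-at-x    : p x ≡ false
    q-at-y    : q y ≡ false
    q-at-x    : q x ≡ true
    elsewhere : ∀ r → r ≢ x → r ≢ y → q r ≡ p r

module _ {p q x y} (L : CellLowered p q x y) {U} (y<U : y < U) where
  open CellLowered L

  -- Both p and q are obtained from insert x p by deleting a single cell.
  private
    m = insert x p

    m-agrees-with-q : ∀ r → r ≢ y → m r ≡ q r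
    m-agrees-with-q r r≢y with r ≟ x
    ... | yes refl = trans (insert-here r p) (sym q-at-x)
    ... | no r≢x   = trans (insert-elsewhere p r≢x) (sym (elsewhere r r≢x r≢y))

    m-at-y : m y ≡ true
    m-at-y = trans (insert-elsewhere p (>⇒≢ x<y)) p-at-y

    count-m-p : ∀ i → i ≤ x → count m U i ≡ suc (count p U i)
    count-m-p i i≤x = count-insert U i (λ r → insert-elsewhere p) p-at-x (insert-here x p) i≤x (<-trans x<y y<U)

    count-m-q : ∀ i → i ≤ y → count m U i ≡ suc (count q U i)
    count-m-q i i≤y = count-insert U i m-agrees-with-q q-at-y m-at-y i≤y y<U

  count-lowered-below : ∀ i → i ≤ x → count q U i ≡ count p U i
  count-lowered-below i i≤x = suc-injective (trans (sym (count-m-q i (≤-trans i≤x (<⇒≤ x<y)))) (count-m-p i i≤x))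

  count-lowered-between : ∀ i → x < i → i ≤ y → count p U i ≡ suc (count q U i)
  count-lowered-between i x<i i≤y =
    trans (count-cong U i (λ r i≤r → sym (insert-elsewhere p (>⇒≢ (<-≤-trans x<i i≤r))))) (count-m-q i i≤y)

  count-lowered-above : ∀ i → y < i → count q U i ≡ count p U i
  count-lowered-above i y<i =
    count-cong U i (λ r i≤r → elsewhere r (>⇒≢ (<-trans x<y (<-≤-trans y<i i≤r))) (>⇒≢ (<-≤-trans y<i i≤r)))

  count-lowered-≤ : ∀ i → count q U i ≤ count p U i
  count-lowered-≤ i with i ≤? x | i ≤? y
  ... | yes i≤x | _       = ≤-reflexive (count-lowered-below i i≤x)
  ... | no i≰x  | yes i≤y = ≤-trans (n≤1+n _) (≤-reflexive (sym (count-lowered-between i (≰⇒> i≰x) i≤y)))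
  ... | no _    | no i≰y  = ≤-reflexive (count-lowered-above i (≰⇒> i≰y))

count-run : ∀ {p q U i y} → (∀ r → i ≤ r → r ≤ y → p r ≡ true) → q y ≡ false →
            count q U (suc y) ≤ count p U (suc y) → i ≤ y → y < U → suc (count q U i) ≤ count p U i
count-run {p} {q} {U} {i} {y} run qy tail i≤y y<U = begin
  suc (count q U i)                               ≡⟨ cong suc (count-split q i≤y (<⇒≤ y<U)) ⟩
  suc (countFrom q i (y ∸ i) + count q U y)       ≡⟨ cong (λ n → suc (_ + n)) (count-false y<U qy) ⟩
  suc (countFrom q i (y ∸ i) + count q U (suc y)) ≤⟨ s≤s (+-mono-≤ (countFrom-≤ q i (y ∸ i)) tail) ⟩
  suc ((y ∸ i) + count p U (suc y))               ≡⟨ sym (+-suc (y ∸ i) _) ⟩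
  (y ∸ i) + suc (count p U (suc y))               ≡⟨ cong₂ _+_ (sym full) (sym (count-true y<U (run y i≤y ≤-refl))) ⟩
  countFrom p i (y ∸ i) + count p U y             ≡⟨ sym (count-split p i≤y (<⇒≤ y<U)) ⟩
  count p U i                                     ∎
  where
  open ≤-Reasoning
  full : countFrom p i (y ∸ i) ≡ y ∸ i
  full = countFrom-full i (y ∸ i) λ r i≤r r<i+y∸i →
    run r i≤r (<⇒≤ (subst (r <_) (m+[n∸m]≡n i≤y) r<i+y∸i))

-- The column condition

module _ (D : Diagram) {r c : ℕ} (Drc : cell D r c ≡ true) where
  1≤row : 1 ≤ r
  1≤row = proj₁ (bounded D r c Drc)
  1≤column : 1 ≤ c
  1≤column = proj₁ (proj₂ (bounded D r c Drc))
  row<bound : r < bound D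
  row<bound = proj₁ (proj₂ (proj₂ (bounded D r c Drc)))
  column<bound : c < bound D
  column<bound = proj₂ (proj₂ (proj₂ (bounded D r c Drc)))

column : Diagram → ℕ → ℕ → Bool
column D j r = cell D r j

-- Counting up to a common row U lets diagrams with different bounds be compared.
ColumnConditionWithin : ℕ → Diagram → Set
ColumnConditionWithin U D =
  ∀ i j → 1 ≤ i → 1 ≤ j → count (column D (suc j)) U i ≤ count (column D j) U i

cell-beyond-bound : ∀ D {r} j → bound D ≤ r → cell D r j ≡ false
cell-beyond-bound D {r} j bD≤r with cell D r j in eq
... | false = refl
... | true  = contradiction (row<bound D eq) (≤⇒≯ bD≤r)

countAbove-within : ∀ D {U} i j → bound D ≤ U → countAbove D i j ≡ count (column D j) U i
countAbove-within D i j = count-extend i (λ r → cell-beyond-bound D j)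

columnCondition⇒within : ∀ D {U} → bound D ≤ U → ColumnCondition D → ColumnConditionWithin U D
columnCondition⇒within D bD≤U cond i j 1≤i 1≤j =
  subst₂ _≤_ (countAbove-within D i (suc j) bD≤U) (countAbove-within D i j bD≤U) (cond i (suc j) 1≤i (s≤s 1≤j))

within⇒columnCondition : ∀ D {U} → bound D ≤ U → ColumnConditionWithin U D → ColumnCondition D
within⇒columnCondition D bD≤U cond i (suc j) 1≤i (s≤s 1≤j) =
  subst₂ _≤_ (sym (countAbove-within D i (suc j) bD≤U)) (sym (countAbove-within D i j bD≤U)) (cond i j 1≤i 1≤j)

columnCondition-trans : ∀ D {U i j k} → ColumnConditionWithin U D → 1 ≤ i → 1 ≤ j → j ≤ k →
                        count (column D k) U i ≤ count (column D j) U i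
columnCondition-trans D {k = k} cond 1≤i 1≤j j≤k with m≤n⇒m<n∨m≡n j≤k
columnCondition-trans D         cond 1≤i 1≤j j≤k   | inj₂ refl = ≤-refl
columnCondition-trans D {k = suc k} cond 1≤i 1≤j _ | inj₁ (s≤s j≤k) =
  ≤-trans (cond _ k 1≤i (≤-trans 1≤j j≤k)) (columnCondition-trans D cond 1≤i 1≤j j≤k)

-- Kohnert moves preserve the column condition

keyCell-intro : ∀ b {r c} → 1 ≤ c → c ≤ entry b r → keyCell b r c ≡ true
keyCell-intro b 1≤c c≤b = Equivalence.to T-≡ (Equivalence.from T-∧ (≤⇒≤ᵇ 1≤c , ≤⇒≤ᵇ c≤b))

keyCell-elim : ∀ b {r c} → keyCell b r c ≡ true → 1 ≤ c × c ≤ entry b r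
keyCell-elim b {r} {c} eq with Equivalence.to T-∧ (Equivalence.from T-≡ eq)
... | 1≤ᵇc , c≤ᵇb = ≤ᵇ⇒≤ 1 c 1≤ᵇc , ≤ᵇ⇒≤ c (entry b r) c≤ᵇb

key-condition : ∀ b U → ColumnConditionWithin U (key b)
key-condition b U i j _ 1≤j = count-mono U i shorter
  where
  shorter : ∀ r → keyCell b r (suc j) ≡ true → keyCell b r j ≡ true
  shorter r eq = keyCell-intro b {r} 1≤j (≤-trans (n≤1+n j) (proj₂ (keyCell-elim b {r} eq)))

record Lowering (D E : Diagram) (c x y : ℕ) : Set where
  field
    lowered   : CellLowered (column D c) (column E c) x y
    unchanged : ∀ j → j ≢ c → ∀ r → cell E r j ≡ cell D r j

count-unchanged : ∀ {D E c x y} → Lowering D E c x y → ∀ {j} U i → j ≢ c →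
                  count (column E j) U i ≡ count (column D j) U i
count-unchanged L U i j≢c = count-cong U i (λ r _ → Lowering.unchanged L _ j≢c r)

lowering-preserves : ∀ {D E U c x y} → Lowering D E c x y → y < U → 1 ≤ c →
                     (∀ r → x < r → r ≤ y → cell D r c ≡ true) → cell D y (suc c) ≡ false →
                     ColumnConditionWithin U D → ColumnConditionWithin U E
lowering-preserves {D} {E} {U} {c} {x} {y} L y<U 1≤c run rightmost condD i j 1≤i 1≤j
  with c ≟ suc j | c ≟ j
... | yes refl | _ = begin
  count (column E (suc j)) U i ≤⟨ count-lowered-≤ (Lowering.lowered L) y<U i ⟩
  count (column D (suc j)) U i ≤⟨ condD i j 1≤i 1≤j ⟩
  count (column D j) U i       ≡⟨ sym (count-unchanged L U i (<⇒≢ (n<1+n j))) ⟩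
  count (column E j) U i       ∎
  where open ≤-Reasoning
... | no _ | yes refl = begin
  count (column E (suc c)) U i ≡⟨ count-unchanged L U i 1+n≢n ⟩
  count (column D (suc c)) U i ≤⟨ next-column ⟩
  count (column E c) U i       ∎
  where
  open ≤-Reasoning
  open Lowering L using (lowered)
  next-column : count (column D (suc c)) U i ≤ count (column E c) U i
  next-column with i ≤? x | i ≤? y
  ... | yes i≤x | _ = ≤-trans (condD i c 1≤i 1≤c) (≤-reflexive (sym (count-lowered-below lowered y<U i i≤x)))
  ... | no i≰x | yes i≤y = ≤-pred (≤-trans
          (count-run (λ r i≤r → run r (<-≤-trans (≰⇒> i≰x) i≤r)) rightmost
                     (condD (suc y) c (s≤s z≤n) 1≤c) i≤y y<U)
          (≤-reflexive (count-lowered-between lowered y<U i (≰⇒> i≰x) i≤y)))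
  ... | no _ | no i≰y =
    ≤-trans (condD i c 1≤i 1≤c) (≤-reflexive (sym (count-lowered-above lowered y<U i (≰⇒> i≰y))))
... | no c≢1+j | no c≢j =
  subst₂ _≤_ (sym (count-unchanged L U i (c≢1+j ∘ sym))) (sym (count-unchanged L U i (c≢j ∘ sym)))
    (condD i j 1≤i 1≤j)

kohnertMove-preserves : ∀ {D E U} → bound D ≤ U → KohnertMove D E →
                        ColumnConditionWithin U D → ColumnConditionWithin U E
kohnertMove-preserves {D} {E} bD≤U (y , c , x , Dyc , rightmost , _ , x<y , Dxc , gap , Eyc , Exc , elsewhere) =
  lowering-preserves L (≤-trans y<bD bD≤U) 1≤c run (rightmost (suc c) (n<1+n c))
  where
  1≤c : 1 ≤ c
  1≤c = 1≤column D Dyc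
  y<bD : y < bound D
  y<bD = row<bound D Dyc
  L : Lowering D E c x y
  L = record
    { lowered   = record
      { x<y = x<y ; p-at-y = Dyc ; p-at-x = Dxc ; q-at-y = Eyc ; q-at-x = Exc
      ; elsewhere = λ r r≢x r≢y → elsewhere r c (r≢y ∘ cong proj₁) (r≢x ∘ cong proj₁) }
    ; unchanged = λ j j≢c r → elsewhere r j (j≢c ∘ cong proj₂) (j≢c ∘ cong proj₂) }
  run : ∀ r → x < r → r ≤ y → cell D r c ≡ true
  run r x<r r≤y with m≤n⇒m<n∨m≡n r≤y
  ... | inj₁ r<y  = gap r x<r r<y
  ... | inj₂ refl = Dyc

kohnertMove-columnCondition : ∀ {D E} → KohnertMove D E → ColumnCondition D → ColumnCondition E
kohnertMove-columnCondition {D} {E} move cond =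
  within⇒columnCondition E (m≤n⊔m (bound D) (bound E))
    (kohnertMove-preserves {D} {E} (m≤m⊔n (bound D) (bound E)) move
      (columnCondition⇒within D (m≤m⊔n (bound D) (bound E)) cond))

≈ᴰ-columnCondition : ∀ {D E} → D ≈ᴰ E → ColumnCondition D → ColumnCondition E
≈ᴰ-columnCondition {D} {E} D≈E cond =
  within⇒columnCondition E (m≤n⊔m (bound D) (bound E)) λ i j 1≤i 1≤j →
    subst₂ _≤_ (count-cong U i (λ r _ → D≈E r (suc j))) (count-cong U i (λ r _ → D≈E r j))
      (columnCondition⇒within D (m≤m⊔n (bound D) (bound E)) cond i j 1≤i 1≤j)
  where
  U = bound D ⊔ bound E

kohnertReach-columnCondition : ∀ {D E} → KohnertReach D E → ColumnCondition D → ColumnCondition E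
kohnertReach-columnCondition ε               cond = cond
kohnertReach-columnCondition {D} (_◅_ {j = E} move moves) cond =
  kohnertReach-columnCondition moves (kohnertMove-columnCondition {D} {E} move cond)

obtainable⇒columnCondition : ∀ D → KohnertObtainable D → ColumnCondition D
obtainable⇒columnCondition D (b , E , moves , E≈D) =
  ≈ᴰ-columnCondition {E} {D} E≈D (kohnertReach-columnCondition moves
    (within⇒columnCondition (key b) ≤-refl (key-condition b (bound (key b)))))

-- Holes

least-below : ∀ {P : ℕ → Set} → Decidable P → ∀ n →
              (∀ x → x < n → ¬ P x) ⊎ ∃[ x ] (x < n × P x × ∀ y → y < x → ¬ P y)
least-below P? zero = inj₁ λ _ ()
least-below P? (suc n) with least-below P? n
... | inj₂ (x , x<n , Px , least) = inj₂ (x , m≤n⇒m≤1+n x<n , Px , least)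
... | inj₁ none with P? n
...   | yes Pn = inj₂ (n , ≤-refl , Pn , none)
...   | no ¬Pn = inj₁ λ x x<1+n → [ none x , (λ { refl → ¬Pn }) ] (m≤n⇒m<n∨m≡n (≤-pred x<1+n))

greatest-below : ∀ {P : ℕ → Set} → Decidable P → ∀ n →
                 (∀ x → x < n → ¬ P x) ⊎ ∃[ x ] (x < n × P x × ∀ y → x < y → y < n → ¬ P y)
greatest-below P? zero = inj₁ λ _ ()
greatest-below P? (suc n) with P? n
... | yes Pn = inj₂ (n , ≤-refl , Pn , λ y n<y y<1+n → contradiction (≤-pred y<1+n) (<⇒≱ n<y))
... | no ¬Pn with greatest-below P? n
...   | inj₂ (x , x<n , Px , greatest) =
        inj₂ (x , m≤n⇒m≤1+n x<n , Px , λ y x<y y<1+n →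
                [ greatest y x<y , (λ { refl → ¬Pn }) ] (m≤n⇒m<n∨m≡n (≤-pred y<1+n)))
...   | inj₁ none = inj₁ λ x x<1+n → [ none x , (λ { refl → ¬Pn }) ] (m≤n⇒m<n∨m≡n (≤-pred x<1+n))

Hole : Diagram → ℕ → ℕ → Set
Hole D a c = suc a < bound D × cell D a c ≡ true × cell D (suc a) c ≡ false

hole? : ∀ D a → Decidable (Hole D a)
hole? D a c = (suc a <? bound D) ×-dec (cell D a c ≟ᴮ true) ×-dec (cell D (suc a) c ≟ᴮ false)

NoHoleFrom : Diagram → ℕ → Set
NoHoleFrom D s = ∀ a c → s ≤ a → ¬ Hole D a c

LeftmostHole : Diagram → ℕ → ℕ → Set
LeftmostHole D a c = Hole D a c × ∀ j → j < c → ¬ Hole D a j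

noHole⊎leftmostHole : ∀ D a → (∀ c → ¬ Hole D a c) ⊎ ∃[ c ] LeftmostHole D a c
noHole⊎leftmostHole D a with least-below (hole? D a) (bound D)
... | inj₂ (c , _ , hole , leftmost) = inj₂ (c , hole , leftmost)
... | inj₁ none = inj₁ λ c hole@(_ , Dac , _) → none c (column<bound D Dac) hole

rowHole? : ∀ D → Decidable (λ a → ∃[ c ] Hole D a c)
rowHole? D a with noHole⊎leftmostHole D a
... | inj₁ none              = no λ (c , hole) → none c hole
... | inj₂ (c , hole , _)    = yes (c , hole)

noHole⊎topmostLeftmostHole : ∀ D → NoHoleFrom D 0 ⊎ ∃[ a ] ∃[ c ] (LeftmostHole D a c × NoHoleFrom D (suc a))
noHole⊎topmostLeftmostHole D with greatest-below (rowHole? D) (bound D)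
... | inj₁ none = inj₁ λ a c _ hole → none a (<-trans (n<1+n a) (proj₁ hole)) (c , hole)
... | inj₂ (a , _ , (c₀ , hole₀) , topmost) with noHole⊎leftmostHole D a
...   | inj₁ none = contradiction hole₀ (none c₀)
...   | inj₂ (c , leftmost) =
        inj₂ (a , c , leftmost , λ y j a<y hole → topmost y a<y (<-trans (n<1+n y) (proj₁ hole)) (j , hole))

column-full : ∀ {D s r j} → NoHoleFrom D s → s ≤ r → cell D r j ≡ true →
              count (column D j) (bound D) r ≡ bound D ∸ r
column-full {D} {s} {r} {j} noHole s≤r Drj = count-full filled
  where
  filled : ∀ t → r ≤ t → t < bound D → cell D t j ≡ true
  filled t r≤t t<B with m≤n⇒m<n∨m≡n r≤t
  filled t       r≤t t<B | inj₂ refl = Drj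
  filled (suc t) r≤t t<B | inj₁ (s≤s r≤t') with cell D (suc t) j in Dtj
  ... | true  = refl
  ... | false = contradiction (t<B , filled t r≤t' (<-trans (n<1+n t) t<B) , Dtj) (noHole t j (≤-trans s≤r r≤t'))

entry-applyUpTo : ∀ (f : ℕ → ℕ) n r → (∀ r → n ≤ r → f (suc r) ≡ 0) →
                  entry (applyUpTo (f ∘ suc) n) (suc r) ≡ f (suc r)
entry-applyUpTo f zero    r       vanish = sym (vanish r z≤n)
entry-applyUpTo f (suc n) zero    vanish = refl
entry-applyUpTo f (suc n) (suc r) vanish = entry-applyUpTo (f ∘ suc) n r (λ r n≤r → vanish (suc r) (s≤s n≤r))

module HoleFree (D : Diagram) (noHole : NoHoleFrom D 0) (cond : ColumnConditionWithin (bound D) D) where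

  row-left-step : ∀ {r j} → 1 ≤ j → cell D r (suc j) ≡ true → cell D r j ≡ true
  row-left-step {r} {j} 1≤j Dr[1+j] with cell D r j in Drj
  ... | true  = refl
  ... | false = contradiction (cond r j 1≤r 1≤j) (<⇒≱ (begin-strict
    count (column D j) (bound D) r       <⟨ count-<-window Drj r<B ⟩
    bound D ∸ r                          ≡⟨ sym (column-full {D} noHole z≤n Dr[1+j]) ⟩
    count (column D (suc j)) (bound D) r ∎))
    where
    open ≤-Reasoning
    1≤r = 1≤row D Dr[1+j]
    r<B = row<bound D Dr[1+j]

  row-left-closed : ∀ {r j k} → 1 ≤ j → j ≤ k → cell D r k ≡ true → cell D r j ≡ true
  row-left-closed {k = k} 1≤j j≤k Drk with m≤n⇒m<n∨m≡n j≤k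
  row-left-closed         1≤j j≤k Drk | inj₂ refl = Drk
  row-left-closed {k = suc k} 1≤j _ Drk | inj₁ (s≤s j≤k) =
    row-left-closed 1≤j j≤k (row-left-step (≤-trans 1≤j j≤k) Drk)

  rowLength : ℕ → ℕ
  rowLength r with greatest-below (λ c → cell D r c ≟ᴮ true) (bound D)
  ... | inj₁ _           = 0
  ... | inj₂ (c , _)     = c

  rowLength-spec : ∀ r → (rowLength r ≡ 0 × ∀ c → cell D r c ≢ true)
                       ⊎ (cell D r (rowLength r) ≡ true × ∀ c → cell D r c ≡ true → c ≤ rowLength r)
  rowLength-spec r with greatest-below (λ c → cell D r c ≟ᴮ true) (bound D)
  ... | inj₁ none = inj₁ (refl , λ c Drc → none c (column<bound D Drc) Drc)
  ... | inj₂ (ℓ , _ , Drℓ , greatest) =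
    inj₂ (Drℓ , λ c Drc → ≮⇒≥ λ ℓ<c → greatest c ℓ<c (column<bound D Drc) Drc)

  rowLength-empty : ∀ {r} → (∀ c → cell D r c ≢ true) → rowLength r ≡ 0
  rowLength-empty {r} empty with rowLength-spec r
  ... | inj₁ (len≡0 , _) = len≡0
  ... | inj₂ (Drℓ , _)   = contradiction Drℓ (empty _)

  cell⇔rowLength : ∀ r c → cell D r c ≡ true ⇔ (1 ≤ c × c ≤ rowLength r)
  cell⇔rowLength r c = mk⇔ to from
    where
    to : cell D r c ≡ true → 1 ≤ c × c ≤ rowLength r
    to Drc with rowLength-spec r
    ... | inj₁ (_ , empty)    = contradiction Drc (empty c)
    ... | inj₂ (_ , longest) = 1≤column D Drc , longest c Drc
    from : 1 ≤ c × c ≤ rowLength r → cell D r c ≡ true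
    from (1≤c , c≤len) with rowLength-spec r
    ... | inj₁ (len≡0 , _) = contradiction (≤-trans 1≤c (≤-trans c≤len (≤-reflexive len≡0))) λ ()
    ... | inj₂ (Drℓ , _)   = row-left-closed 1≤c c≤len Drℓ

  shape : List ℕ
  shape = applyUpTo (rowLength ∘ suc) (bound D)

  entry-shape : ∀ r → entry shape r ≡ rowLength r
  entry-shape zero    = sym (rowLength-empty λ c D0c → contradiction (1≤row D D0c) λ ())
  entry-shape (suc r) = entry-applyUpTo rowLength (bound D) r λ r B≤r →
    rowLength-empty λ c Dc → contradiction (row<bound D Dc) (≤⇒≯ (m≤n⇒m≤1+n B≤r))

  key≈ᴰ : key shape ≈ᴰ D
  key≈ᴰ r c = ⇔→≡ {z = true} (mk⇔
    (λ keyrc → Equivalence.from (cell⇔rowLength r c)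
                 (subst (λ n → 1 ≤ c × c ≤ n) (entry-shape r) (keyCell-elim shape {r} keyrc)))
    (λ Drc → let 1≤c , c≤len = Equivalence.to (cell⇔rowLength r c) Drc in
             keyCell-intro shape {r} 1≤c (≤-trans c≤len (≤-reflexive (sym (entry-shape r))))))

-- Filling holes by inverse Kohnert moves

raisedCell : Diagram → ℕ → ℕ → ℕ → ℕ → Bool
raisedCell D a c r j with j ≟ c | r ≟ suc a | r ≟ a
... | no _  | _     | _     = cell D r j
... | yes _ | yes _ | _     = true
... | yes _ | no _  | yes _ = false
... | yes _ | no _  | no _  = cell D r j

raise : (D : Diagram) {a c : ℕ} → Hole D a c → Diagram
raise D {a} {c} (a+1<B , Dac , _) = record
  { cell    = raisedCell D a c
  ; bound   = bound D
  ; bounded = raised-bounded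
  }
  where
  raised-bounded : ∀ r j → raisedCell D a c r j ≡ true →
                   (1 ≤ r) × (1 ≤ j) × (r < bound D) × (j < bound D)
  raised-bounded r j eq with j ≟ c | r ≟ suc a | r ≟ a
  ... | no _     | _        | _     = bounded D r j eq
  ... | yes refl | yes refl | _     = s≤s z≤n , 1≤column D Dac , a+1<B , column<bound D Dac
  ... | yes _    | no _     | no _  = bounded D r j eq

raise-lowering : ∀ D {a c} (hole : Hole D a c) → Lowering (raise D hole) D c a (suc a)
raise-lowering D {a} {c} hole@(_ , Dac , Da+1c) = record
  { lowered   = record
    { x<y       = n<1+n a
    ; p-at-y    = top
    ; p-at-x    = bottom
    ; q-at-y    = Da+1c
    ; q-at-x    = Dac
    ; elsewhere = elsewhere
    }
  ; unchanged = otherColumn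
  }
  where
  top : raisedCell D a c (suc a) c ≡ true
  top with c ≟ c | suc a ≟ suc a
  ... | yes _   | yes _   = refl
  ... | no c≢c  | _       = contradiction refl c≢c
  ... | yes _   | no ≢    = contradiction refl ≢
  bottom : raisedCell D a c a c ≡ false
  bottom with c ≟ c | a ≟ suc a | a ≟ a
  ... | yes _   | no _    | yes _ = refl
  ... | no c≢c  | _       | _     = contradiction refl c≢c
  ... | yes _   | yes a≡  | _     = contradiction a≡ (<⇒≢ (n<1+n a))
  ... | yes _   | no _    | no ≢  = contradiction refl ≢
  elsewhere : ∀ r → r ≢ a → r ≢ suc a → cell D r c ≡ raisedCell D a c r c
  elsewhere r r≢a r≢a+1 with c ≟ c | r ≟ suc a | r ≟ a
  ... | yes _   | no _    | no _   = refl
  ... | no c≢c  | _       | _      = contradiction refl c≢c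
  ... | yes _   | yes r≡  | _      = contradiction r≡ r≢a+1
  ... | yes _   | no _    | yes r≡ = contradiction r≡ r≢a
  otherColumn : ∀ j → j ≢ c → ∀ r → cell D r j ≡ raisedCell D a c r j
  otherColumn j j≢c r with j ≟ c
  ... | no _    = refl
  ... | yes j≡c = contradiction j≡c j≢c

lowering-by-one⇒kohnertMove : ∀ {D E c x} → Lowering D E c x (suc x) → 1 ≤ x →
                              (∀ j → c < j → cell D (suc x) j ≡ false) → KohnertMove D E
lowering-by-one⇒kohnertMove {D} {E} {c} {x} L 1≤x rightmost =
  suc x , c , x , p-at-y , rightmost , 1≤x , n<1+n x , p-at-x
  , (λ r x<r r<1+x → contradiction (≤-pred r<1+x) (<⇒≱ x<r))
  , q-at-y , q-at-x , fixed
  where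
  open Lowering L
  open CellLowered lowered
  fixed : ∀ r j → (r , j) ≢ (suc x , c) → (r , j) ≢ (x , c) → cell E r j ≡ cell D r j
  fixed r j ≢top ≢bottom with j ≟ c
  ... | yes refl = elsewhere r (λ r≡x → ≢bottom (cong (_, j) r≡x)) (λ r≡1+x → ≢top (cong (_, j) r≡1+x))
  ... | no j≢c   = unchanged j j≢c r

sumBelow : ℕ → (ℕ → ℕ) → ℕ
sumBelow zero    f = 0
sumBelow (suc n) f = f n + sumBelow n f

sumBelow-mono : ∀ n {f g} → (∀ x → x < n → f x ≤ g x) → sumBelow n f ≤ sumBelow n g
sumBelow-mono zero    f≤g = z≤n
sumBelow-mono (suc n) f≤g = +-mono-≤ (f≤g n ≤-refl) (sumBelow-mono n (λ x → f≤g x ∘ m≤n⇒m≤1+n))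

sumBelow-strict : ∀ n {f g} → (∀ x → x < n → f x ≤ g x) → ∀ {x} → x < n → f x < g x →
                  sumBelow n f < sumBelow n g
sumBelow-strict (suc n) f≤g {x} x<1+n fx<gx with x ≟ n
... | yes refl = +-mono-<-≤ fx<gx (sumBelow-mono n (λ y → f≤g y ∘ m≤n⇒m≤1+n))
... | no x≢n   =
  +-mono-≤-< (f≤g n ≤-refl) (sumBelow-strict n (λ y → f≤g y ∘ m≤n⇒m≤1+n) (≤∧≢⇒< (≤-pred x<1+n) x≢n) fx<gx)

sumBelow-≤ : ∀ n {f m} → (∀ x → x < n → f x ≤ m) → sumBelow n f ≤ n * m
sumBelow-≤ zero    f≤m = z≤n
sumBelow-≤ (suc n) f≤m = +-mono-≤ (f≤m n ≤-refl) (sumBelow-≤ n (λ x → f≤m x ∘ m≤n⇒m≤1+n))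

weight : Diagram → ℕ
weight D = sumBelow (bound D) λ j → sumBelow (bound D) λ i → count (column D j) (bound D) i

weight-≤ : ∀ D → weight D ≤ bound D * (bound D * bound D)
weight-≤ D = sumBelow-≤ (bound D) λ j _ → sumBelow-≤ (bound D) λ i _ →
  ≤-trans (count-≤ (column D j) (bound D) i) (m∸n≤m (bound D) i)

module Raised {D : Diagram} {a c} (hole : LeftmostHole D a c) where
  D′ : Diagram
  D′ = raise D (proj₁ hole)
  L : Lowering D′ D c a (suc a)
  L = raise-lowering D (proj₁ hole)
  lowered : CellLowered (column D′ c) (column D c) a (suc a)
  lowered = Lowering.lowered L
  a+1<B : suc a < bound D
  a+1<B = proj₁ (proj₁ hole)

module _ {D : Diagram} (cond : ColumnConditionWithin (bound D) D) where

  row-ends-above-hole : ∀ {a c j} → Hole D a c → NoHoleFrom D (suc a) → c < j → cell D (suc a) j ≡ false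
  row-ends-above-hole {a} {c} {j} (a+1<B , Dac , Da+1c) noHoleAbove c<j with cell D (suc a) j in Da+1j
  ... | false = refl
  ... | true  = contradiction (begin-strict
    bound D ∸ suc a                    ≡⟨ sym (column-full {D} noHoleAbove ≤-refl Da+1j) ⟩
    count (column D j) (bound D) (suc a) ≤⟨ columnCondition-trans D cond (s≤s z≤n) 1≤c (<⇒≤ c<j) ⟩
    count (column D c) (bound D) (suc a) <⟨ count-<-window Da+1c a+1<B ⟩
    bound D ∸ suc a                    ∎) (<-irrefl refl)
    where
    open ≤-Reasoning
    1≤c = 1≤column D Dac

  left-of-leftmost-hole : ∀ {a j} → LeftmostHole D a (suc j) → NoHoleFrom D (suc a) → 1 ≤ j →
                          suc (count (column D (suc j)) (bound D) (suc a)) ≤ count (column D j) (bound D) (suc a)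
  left-of-leftmost-hole {a} {j} ((a+1<B , Dac , Da+1c) , leftmost) noHoleAbove 1≤j with cell D a j in Daj
  ... | false = begin
    suc (count (column D (suc j)) (bound D) (suc a)) ≡⟨ sym (count-true a<B Dac) ⟩
    count (column D (suc j)) (bound D) a             ≤⟨ cond a j (1≤row D Dac) 1≤j ⟩
    count (column D j) (bound D) a                   ≡⟨ count-false a<B Daj ⟩
    count (column D j) (bound D) (suc a)             ∎
    where
    open ≤-Reasoning
    a<B = <-trans (n<1+n a) a+1<B
  ... | true with cell D (suc a) j in Da+1j
  ...   | false = contradiction (a+1<B , Daj , Da+1j) (leftmost j ≤-refl)
  ...   | true  = begin
    suc (count (column D (suc j)) (bound D) (suc a)) ≤⟨ count-<-window Da+1c a+1<B ⟩
    bound D ∸ suc a                                  ≡⟨ sym (column-full {D} noHoleAbove ≤-refl Da+1j) ⟩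
    count (column D j) (bound D) (suc a)             ∎
    where open ≤-Reasoning


  raise-columnCondition : ∀ {a c} (hole : LeftmostHole D a c) → NoHoleFrom D (suc a) →
                          ColumnConditionWithin (bound D) (raise D (proj₁ hole))
  -- Splitting on c ≟ suc j, not suc j ≟ c, keeps the with-abstraction away from the test inside raisedCell.
  raise-columnCondition {a} {c} hole noHoleAbove i j 1≤i 1≤j with c ≟ suc j | c ≟ j
  ... | yes refl | _ = begin
    count (column D′ (suc j)) (bound D) i ≤⟨ raised-column ⟩
    count (column D j) (bound D) i        ≡⟨ count-unchanged L (bound D) i (<⇒≢ (n<1+n j)) ⟩
    count (column D′ j) (bound D) i       ∎
    where
    open ≤-Reasoning
    open Raised {D} hole
    raised-column : count (column D′ (suc j)) (bound D) i ≤ count (column D j) (bound D) i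
    raised-column with i ≟ suc a | i ≤? a
    ... | yes refl | _ = ≤-trans (≤-reflexive (count-lowered-between lowered a+1<B i ≤-refl ≤-refl))
                                 (left-of-leftmost-hole hole noHoleAbove 1≤j)
    ... | no _ | yes i≤a = ≤-trans (≤-reflexive (sym (count-lowered-below lowered a+1<B i i≤a))) (cond i j 1≤i 1≤j)
    ... | no i≢a+1 | no i≰a =
      ≤-trans (≤-reflexive (sym (count-lowered-above lowered a+1<B i (≤∧≢⇒< (≰⇒> i≰a) (i≢a+1 ∘ sym)))))
              (cond i j 1≤i 1≤j)
  ... | no _ | yes refl = begin
    count (column D′ (suc c)) (bound D) i ≡⟨ sym (count-unchanged L (bound D) i 1+n≢n) ⟩
    count (column D (suc c)) (bound D) i  ≤⟨ cond i c 1≤i 1≤j ⟩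
    count (column D c) (bound D) i        ≤⟨ count-lowered-≤ lowered a+1<B i ⟩
    count (column D′ c) (bound D) i       ∎
    where
    open ≤-Reasoning
    open Raised {D} hole
  ... | no c≢1+j | no c≢j =
    subst₂ _≤_ (count-unchanged L (bound D) i (c≢1+j ∘ sym)) (count-unchanged L (bound D) i (c≢j ∘ sym))
      (cond i j 1≤i 1≤j)
    where open Raised {D} hole

  raise-kohnertMove : ∀ {a c} (hole : LeftmostHole D a c) → NoHoleFrom D (suc a) → KohnertMove (raise D (proj₁ hole)) D
  raise-kohnertMove {a} {c} hole@((_ , Dac , _) , _) noHoleAbove =
    lowering-by-one⇒kohnertMove L (1≤row D Dac) λ j c<j →
      trans (sym (Lowering.unchanged L j (>⇒≢ c<j) (suc a))) (row-ends-above-hole (proj₁ hole) noHoleAbove c<j)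
    where open Raised {D} hole

weight-raise : ∀ {D a c} (hole : LeftmostHole D a c) → weight D < weight (raise D (proj₁ hole))
weight-raise {D} {a} {c} hole@((_ , Dac , _) , _) =
  sumBelow-strict (bound D) (λ j _ → sumBelow-mono (bound D) λ i _ → raised-≥ j i) c<B
    (sumBelow-strict (bound D) (λ i _ → raised-≥ c i) a+1<B
      (≤-reflexive (sym (count-lowered-between lowered a+1<B (suc a) ≤-refl ≤-refl))))
  where
  open Raised {D} hole
  c<B : c < bound D
  c<B = column<bound D Dac
  raised-≥ : ∀ j i → count (column D j) (bound D) i ≤ count (column D′ j) (bound D) i
  raised-≥ j i with c ≟ j
  ... | yes refl = count-lowered-≤ lowered a+1<B i
  ... | no c≢j   = ≤-reflexive (count-unchanged L (bound D) i (c≢j ∘ sym))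

kohnertMove-≈ᴰ : ∀ {F D E} → F ≈ᴰ D → KohnertMove D E → KohnertMove F E
kohnertMove-≈ᴰ F≈D (y , c , x , Dyc , rightmost , 1≤x , x<y , Dxc , gap , Eyc , Exc , elsewhere) =
  y , c , x , trans (F≈D y c) Dyc , (λ j c<j → trans (F≈D y j) (rightmost j c<j)) , 1≤x , x<y
  , trans (F≈D x c) Dxc , (λ r x<r r<y → trans (F≈D r c) (gap r x<r r<y)) , Eyc , Exc
  , (λ r j ≢top ≢bottom → trans (elsewhere r j ≢top ≢bottom) (sym (F≈D r j)))

obtainable-step : ∀ {D E} → KohnertObtainable D → KohnertMove D E → KohnertObtainable E
obtainable-step {D} {E} (b , F , moves , F≈D) move =
  b , E , moves ◅◅ (kohnertMove-≈ᴰ {F} {D} {E} F≈D move ◅ ε) , λ _ _ → refl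

condition⇒obtainable : ∀ k D → ColumnConditionWithin (bound D) D →
                       bound D * (bound D * bound D) ∸ weight D < k → KohnertObtainable D
condition⇒obtainable (suc k) D cond (s≤s slack≤k) with noHole⊎topmostLeftmostHole D
... | inj₁ noHole = shape , key shape , ε , key≈ᴰ
  where open HoleFree D noHole cond
... | inj₂ (a , c , hole , noHoleAbove) =
  obtainable-step {D′} {D} (condition⇒obtainable k D′ (raise-columnCondition cond hole noHoleAbove) slack′<k)
                  (raise-kohnertMove cond hole noHoleAbove)
  where
  open Raised {D} hole using (D′)
  slack′<k : bound D * (bound D * bound D) ∸ weight D′ < k
  slack′<k = <-≤-trans (∸-monoʳ-< (weight-raise hole) (weight-≤ D′)) slack≤k

lemma2p2 : (D : Diagram) →
    (KohnertObtainable D → ColumnCondition D) × (ColumnCondition D → KohnertObtainable D)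
lemma2p2 D =
  obtainable⇒columnCondition D ,
  λ cond → condition⇒obtainable _ D (columnCondition⇒within D ≤-refl cond) ≤-refl
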